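{- Suppose the prices are multiplicative, i.e., there are $p_1,\dots,p_m>0$ and $q_1,\dots,q_n>0$ with $p_{ij}=p_i q_j$ for all $(i,j)\in[m]\times[n]$. Then a set $S\subseteq[m]\times[n]$ can be captured (i.e., there exist nonnegative reals $r_1,\dots,r_m,c_1,\dots,c_n$ such that $\{(i,j): r_ic_j\ge p_{ij}\}=S$) if and only if $S$ is a staircase.
   Context: A set $S\subseteq[m]\times[n]$ is a staircase if for every two columns $j_1,j_2\in[n]$, the set $S\cap([m]\times\{j_1\})$ restricted to rows, $\{i:(i,j_1)\in S\}$, is either a subset or a superset of $\{i:(i,j_2)\in S\}$. -}

module Defs where

open import Data.Nat using (ℕ)
open import Data.Fin using (Fin)
open import Data.Bool using (Bool; true)
open import Data.Product using (_×_; ∃₂)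
open import Data.Sum using (_⊎_)
open import Relation.Binary.PropositionalEquality using (_≡_)
open import Relation.Binary.Structures using (IsTotalOrder)
open import Relation.Nullary using (¬_)
open import Algebra.Structures using (IsCommutativeRing)

-- The standard library has no real numbers.  We state the result for an
-- arbitrary ordered field (with propositional equality on the carrier);
-- the real numbers are an instance.
record OrderedField : Set₁ where
  infixl 7 _*_
  infixl 6 _+_
  infix 4 _≤_
  field
    Carrier : Set
    _+_ _*_ : Carrier → Carrier → Carrier
    -_      : Carrier → Carrier
    0# 1#   : Carrier
    _⁻¹     : Carrier → Carrier
    _≤_     : Carrier → Carrier → Set
    isCommutativeRing : IsCommutativeRing _≡_ _+_ _*_ -_ 0# 1#
    0≢1      : ¬ (0# ≡ 1#)
    ⁻¹-inverse : ∀ x → ¬ (x ≡ 0#) → x * (x ⁻¹) ≡ 1#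
    isTotalOrder : IsTotalOrder _≡_ _≤_
    +-mono-≤ : ∀ {x y} z → x ≤ y → x + z ≤ y + z
    *-nonneg : ∀ {x y} → 0# ≤ x → 0# ≤ y → 0# ≤ x * y

  _<_ : Carrier → Carrier → Set
  x < y = (x ≤ y) × ¬ (x ≡ y)

Grid : ℕ → ℕ → Set
Grid m n = Fin m → Fin n → Bool

IsStaircase : ∀ {m n} → Grid m n → Set
IsStaircase {m} {n} S =
  ∀ (j₁ j₂ : Fin n) →
    (∀ (i : Fin m) → S i j₁ ≡ true → S i j₂ ≡ true)
    ⊎ (∀ (i : Fin m) → S i j₂ ≡ true → S i j₁ ≡ true)

Captured : (F : OrderedField) → ∀ {m n} →
           (Fin m → Fin n → OrderedField.Carrier F) → Grid m n → Set
Captured F {m} {n} P S =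
  ∃₂ λ (r : Fin m → Carrier) (c : Fin n → Carrier) →
    (∀ i → 0# ≤ r i) × (∀ j → 0# ≤ c j) ×
    (∀ i j → (P i j ≤ r i * c j → S i j ≡ true)
           × (S i j ≡ true → P i j ≤ r i * c j))
  where open OrderedField F

module Submission where

-- For multiplicative prices, (i , j) is captured iff (rᵢ/pᵢ)(cⱼ/qⱼ) ≥ 1, so the row
-- set of a column only grows with cⱼ/qⱼ and any two columns are nested.
-- Conversely, a staircase is a threshold grid: (i , j) ∈ S iff aᵢ ≤ bⱼ, where bⱼ is
-- the size of column j and aᵢ the number of rows whose row set contains that of
-- row i.  Indeed, if (i , j) ∉ S, the staircase property makes every row of
-- column j such a row, and i itself is one more, outside column j; hence bⱼ < aᵢ.
-- Then rᵢ = pᵢ/(1 + aᵢ) and cⱼ = qⱼ(1 + bⱼ) capture S.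

open import Defs
open import Algebra.Bundles using (CommutativeRing)
import Algebra.Properties.CommutativeSemigroup as CommutativeSemigroupProperties
import Algebra.Properties.Ring as RingProperties
open import Data.Bool using (Bool; true; false)
open import Data.Fin using (Fin)
open import Data.Fin.Subset using (Subset; _∈_; _⊆_; _⊂_; ∣_∣)
open import Data.Fin.Subset.Properties using (_⊆?_; ⊆-refl; p⊆q⇒∣p∣≤∣q∣; p⊂q⇒∣p∣<∣q∣)
open import Data.Nat using (ℕ)
import Data.Nat as ℕ
open import Data.Nat.Properties using (<⇒≱)
open import Data.Product using (_×_; _,_; proj₁; proj₂; ∃₂)
open import Data.Sum using (inj₁; inj₂)
import Data.Sum as Sum
open import Data.Vec using (tabulate)
open import Data.Vec.Properties using (lookup∘tabulate; []=⇒lookup; lookup⇒[]=)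
open import Function.Bundles using (_⇔_; mk⇔; Equivalence)
open import Relation.Binary.Bundles using (Poset)
open import Relation.Binary.PropositionalEquality using (_≡_; refl; sym; trans; cong; subst)
import Relation.Binary.Reasoning.PartialOrder as ≤-Reasoning
open import Relation.Binary.Structures using (IsTotalOrder)
open import Relation.Nullary using (¬_; contradiction; does; yes; no)
open import Relation.Nullary.Decidable using (dec-true)

∈-tabulate⁺ : ∀ {n} {f : Fin n → Bool} {x} → f x ≡ true → x ∈ tabulate f
∈-tabulate⁺ {f = f} {x} fx≡true = lookup⇒[]= x (tabulate f) (trans (lookup∘tabulate f x) fx≡true)

∈-tabulate⁻ : ∀ {n} {f : Fin n → Bool} {x} → x ∈ tabulate f → f x ≡ true
∈-tabulate⁻ {f = f} {x} x∈f = trans (sym (lookup∘tabulate f x)) ([]=⇒lookup x∈f)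

IsThreshold : ∀ {m n} → Grid m n → Set
IsThreshold {m} {n} S =
  ∃₂ λ (a : Fin m → ℕ) (b : Fin n → ℕ) → ∀ i j → S i j ≡ true ⇔ a i ℕ.≤ b j

module _ {m n : ℕ} (S : Grid m n) where

  row : Fin m → Subset n
  row i = tabulate (S i)

  column : Fin n → Subset m
  column j = tabulate (λ i → S i j)

  dominators : Fin m → Subset m
  dominators i = tabulate (λ i′ → does (row i ⊆? row i′))

  ∈-dominators⁺ : ∀ {i i′} → row i ⊆ row i′ → i′ ∈ dominators i
  ∈-dominators⁺ {i} {i′} row⊆ = ∈-tabulate⁺ (dec-true (row i ⊆? row i′) row⊆)

  ∈-dominators⁻ : ∀ {i i′} → i′ ∈ dominators i → row i ⊆ row i′
  ∈-dominators⁻ {i} {i′} i′∈ with row i ⊆? row i′ | ∈-tabulate⁻ i′∈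
  ... | yes row⊆ | _  = row⊆
  ... | no _     | ()

  dominators⊆column : ∀ {i j} → S i j ≡ true → dominators i ⊆ column j
  dominators⊆column Sij≡true i′∈ =
    ∈-tabulate⁺ (∈-tabulate⁻ (∈-dominators⁻ i′∈ (∈-tabulate⁺ Sij≡true)))

  module _ (staircase : IsStaircase S) where

    ∉-column⇒row⊆row : ∀ {i i′ j} → S i j ≡ false → S i′ j ≡ true → row i ⊆ row i′
    ∉-column⇒row⊆row {i} {i′} {j} Sij≡false Si′j≡true {j′} j′∈ with staircase j j′
    ... | inj₁ column⊆ = ∈-tabulate⁺ (column⊆ i′ Si′j≡true)
    ... | inj₂ column⊇ = contradiction (trans (sym (column⊇ i (∈-tabulate⁻ j′∈))) Sij≡false) λ ()

    column⊂dominators : ∀ {i j} → S i j ≡ false → column j ⊂ dominators i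
    column⊂dominators {i} Sij≡false =
      (λ i′∈ → ∈-dominators⁺ (∉-column⇒row⊆row Sij≡false (∈-tabulate⁻ i′∈))) ,
      i , ∈-dominators⁺ ⊆-refl ,
      λ i∈ → contradiction (trans (sym (∈-tabulate⁻ i∈)) Sij≡false) λ ()

    staircase⇒threshold : IsThreshold S
    staircase⇒threshold =
      (λ i → ∣ dominators i ∣) , (λ j → ∣ column j ∣) ,
      λ i j → mk⇔ (λ Sij≡true → p⊆q⇒∣p∣≤∣q∣ (dominators⊆column Sij≡true)) (≤⇒∈ i j)
      where
      ≤⇒∈ : ∀ i j → ∣ dominators i ∣ ℕ.≤ ∣ column j ∣ → S i j ≡ true
      ≤⇒∈ i j ≤ with S i j in Sij
      ... | true  = refl
      ... | false = contradiction ≤ (<⇒≱ (p⊂q⇒∣p∣<∣q∣ (column⊂dominators Sij)))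

module OrderedFieldProperties (F : OrderedField) where

  open OrderedField F
  open IsTotalOrder isTotalOrder using (total; antisym; reflexive; isPartialOrder)

  ring : CommutativeRing _ _
  ring = record { isCommutativeRing = isCommutativeRing }

  open CommutativeRing ring
    using (_-_; +-assoc; +-identityˡ; +-identityʳ; -‿inverseˡ; -‿inverseʳ;
           *-comm; *-assoc; *-identityˡ; zeroʳ)
  open RingProperties (CommutativeRing.ring ring) using (-1*x≈-x; -‿involutive; [y-z]x≈yx-zx)

  poset : Poset _ _ _
  poset = record { isPartialOrder = isPartialOrder }

  open ≤-Reasoning poset

  x≤y⇒0≤y-x : ∀ {x y} → x ≤ y → 0# ≤ y - x
  x≤y⇒0≤y-x {x} {y} x≤y = begin
    0#     ≡⟨ sym (-‿inverseʳ x) ⟩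
    x - x  ≤⟨ +-mono-≤ (- x) x≤y ⟩
    y - x  ∎

  0≤y-x⇒x≤y : ∀ {x y} → 0# ≤ y - x → x ≤ y
  0≤y-x⇒x≤y {x} {y} 0≤y-x = begin
    x              ≡⟨ sym (+-identityˡ x) ⟩
    0# + x         ≤⟨ +-mono-≤ x 0≤y-x ⟩
    y - x + x      ≡⟨ +-assoc y (- x) x ⟩
    y + (- x + x)  ≡⟨ cong (y +_) (-‿inverseˡ x) ⟩
    y + 0#         ≡⟨ +-identityʳ y ⟩
    y              ∎

  +-cancelʳ-≤ : ∀ {x y} z → x + z ≤ y + z → x ≤ y
  +-cancelʳ-≤ {x} {y} z x+z≤y+z = begin
    x            ≡⟨ sym (cancel x) ⟩
    x + z - z    ≤⟨ +-mono-≤ (- z) x+z≤y+z ⟩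
    y + z - z    ≡⟨ cancel y ⟩
    y            ∎
    where
    cancel : ∀ w → w + z - z ≡ w
    cancel w = trans (+-assoc w z (- z)) (trans (cong (w +_) (-‿inverseʳ z)) (+-identityʳ w))

  *-monoʳ-≤ : ∀ {x y} z → 0# ≤ z → x ≤ y → x * z ≤ y * z
  *-monoʳ-≤ {x} {y} z 0≤z x≤y =
    0≤y-x⇒x≤y (begin
      0#               ≤⟨ *-nonneg (x≤y⇒0≤y-x x≤y) 0≤z ⟩
      (y - x) * z      ≡⟨ [y-z]x≈yx-zx z y x ⟩
      y * z - x * z    ∎)

  *-monoˡ-≤ : ∀ {x y} z → 0# ≤ z → x ≤ y → z * x ≤ z * y
  *-monoˡ-≤ {x} {y} z 0≤z x≤y = begin
    z * x  ≡⟨ *-comm z x ⟩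
    x * z  ≤⟨ *-monoʳ-≤ z 0≤z x≤y ⟩
    y * z  ≡⟨ *-comm y z ⟩
    z * y  ∎

  0≤1 : 0# ≤ 1#
  0≤1 with total 0# 1#
  ... | inj₁ 0≤1′ = 0≤1′
  ... | inj₂ 1≤0 = begin
    0#           ≤⟨ *-nonneg 0≤-1 0≤-1 ⟩
    - 1# * - 1#  ≡⟨ -1*x≈-x (- 1#) ⟩
    - - 1#       ≡⟨ -‿involutive 1# ⟩
    1#           ∎
    where
    0≤-1 : 0# ≤ - 1#
    0≤-1 = subst (0# ≤_) (+-identityˡ (- 1#)) (x≤y⇒0≤y-x 1≤0)

  1≰0 : ¬ (1# ≤ 0#)
  1≰0 1≤0 = 0≢1 (antisym 0≤1 1≤0)

  x*x⁻¹≡1 : ∀ {x} → 0# < x → x * x ⁻¹ ≡ 1#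
  x*x⁻¹≡1 {x} (_ , 0≢x) = ⁻¹-inverse x (λ x≡0 → 0≢x (sym x≡0))

  x⁻¹*x≡1 : ∀ {x} → 0# < x → x ⁻¹ * x ≡ 1#
  x⁻¹*x≡1 {x} 0<x = trans (*-comm (x ⁻¹) x) (x*x⁻¹≡1 0<x)

  ⁻¹-pos : ∀ {x} → 0# < x → 0# < (x ⁻¹)
  ⁻¹-pos {x} 0<x@(0≤x , _) = 0≤x⁻¹ , λ 0≡x⁻¹ → 0≢1 (begin-equality
      0#        ≡⟨ sym (zeroʳ x) ⟩
      x * 0#    ≡⟨ cong (x *_) 0≡x⁻¹ ⟩
      x * x ⁻¹  ≡⟨ x*x⁻¹≡1 0<x ⟩
      1#        ∎)
    where
    0≤x⁻¹ : 0# ≤ x ⁻¹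
    0≤x⁻¹ with total 0# (x ⁻¹)
    ... | inj₁ 0≤x⁻¹′ = 0≤x⁻¹′
    ... | inj₂ x⁻¹≤0 = contradiction (begin
      1#        ≡⟨ sym (x*x⁻¹≡1 0<x) ⟩
      x * x ⁻¹  ≤⟨ *-monoˡ-≤ x 0≤x x⁻¹≤0 ⟩
      x * 0#    ≡⟨ zeroʳ x ⟩
      0#        ∎) 1≰0

  *-cancelˡ-≤ : ∀ {x y z} → 0# < x → x * y ≤ x * z → y ≤ z
  *-cancelˡ-≤ {x} {y} {z} 0<x xy≤xz = begin
    y                ≡⟨ sym (cancel y) ⟩
    x ⁻¹ * (x * y)   ≤⟨ *-monoˡ-≤ (x ⁻¹) (proj₁ (⁻¹-pos 0<x)) xy≤xz ⟩
    x ⁻¹ * (x * z)   ≡⟨ cancel z ⟩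
    z                ∎
    where
    cancel : ∀ w → x ⁻¹ * (x * w) ≡ w
    cancel w = trans (sym (*-assoc (x ⁻¹) x w))
                 (trans (cong (_* w) (x⁻¹*x≡1 0<x)) (*-identityˡ w))

  *-pos : ∀ {x y} → 0# < x → 0# < y → 0# < (x * y)
  *-pos {x} {y} 0<x (0≤y , 0≢y) = *-nonneg (proj₁ 0<x) 0≤y , λ 0≡xy →
    0≢y (antisym 0≤y (*-cancelˡ-≤ 0<x (reflexive (trans (sym 0≡xy) (sym (zeroʳ x))))))

  fromℕ : ℕ → Carrier
  fromℕ ℕ.zero    = 0#
  fromℕ (ℕ.suc n) = fromℕ n + 1#

  fromℕ-nonneg : ∀ n → 0# ≤ fromℕ n
  fromℕ-nonneg ℕ.zero    = reflexive refl
  fromℕ-nonneg (ℕ.suc n) = begin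
    0#              ≤⟨ 0≤1 ⟩
    1#              ≡⟨ sym (+-identityˡ 1#) ⟩
    0# + 1#         ≤⟨ +-mono-≤ 1# (fromℕ-nonneg n) ⟩
    fromℕ n + 1#    ∎

  fromℕ-mono-≤ : ∀ {m n} → m ℕ.≤ n → fromℕ m ≤ fromℕ n
  fromℕ-mono-≤ {n = n} ℕ.z≤n = fromℕ-nonneg n
  fromℕ-mono-≤ (ℕ.s≤s m≤n)   = +-mono-≤ 1# (fromℕ-mono-≤ m≤n)

  fromℕ-cancel-≤ : ∀ {m n} → fromℕ m ≤ fromℕ n → m ℕ.≤ n
  fromℕ-cancel-≤ {ℕ.zero}  _ = ℕ.z≤n
  fromℕ-cancel-≤ {ℕ.suc m} {ℕ.zero} 1+m≤0 = contradiction (begin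
    1#            ≡⟨ sym (+-identityˡ 1#) ⟩
    0# + 1#       ≤⟨ +-mono-≤ 1# (fromℕ-nonneg m) ⟩
    fromℕ m + 1#  ≤⟨ 1+m≤0 ⟩
    0#            ∎) 1≰0
  fromℕ-cancel-≤ {ℕ.suc m} {ℕ.suc n} 1+m≤1+n = ℕ.s≤s (fromℕ-cancel-≤ (+-cancelʳ-≤ 1# 1+m≤1+n))

  fromℕ-suc-pos : ∀ n → 0# < fromℕ (ℕ.suc n)
  fromℕ-suc-pos n = fromℕ-nonneg (ℕ.suc n) , λ 0≡1+n →
    contradiction (fromℕ-cancel-≤ {ℕ.suc n} {0} (reflexive (sym 0≡1+n))) λ ()

module _ (F : OrderedField) {m n : ℕ}
         {P : Fin m → Fin n → OrderedField.Carrier F}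
         {p : Fin m → OrderedField.Carrier F} {q : Fin n → OrderedField.Carrier F}
         (P≡pq : ∀ i j → P i j ≡ OrderedField._*_ F (p i) (q j)) where

  open OrderedField F
  open OrderedFieldProperties F
  open IsTotalOrder isTotalOrder using (total)
  open CommutativeRing ring using (*-assoc; *-identityʳ; *-commutativeSemigroup)
  open CommutativeSemigroupProperties *-commutativeSemigroup
    using (x∙yz≈y∙xz; x∙yz≈y∙zx; x∙yz≈z∙xy; x∙yz≈z∙yx)
  open ≤-Reasoning poset

  captured⇒staircase : (∀ j → 0# < q j) → ∀ {S} → Captured F P S → IsStaircase S
  captured⇒staircase 0<q {S} (r , c , 0≤r , _ , capture) j₁ j₂ =
    Sum.map (column⊆ j₁ j₂) (column⊆ j₂ j₁) (total (c j₁ * q j₂) (c j₂ * q j₁))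
    where
    column⊆ : ∀ j j′ → c j * q j′ ≤ c j′ * q j → ∀ i → S i j ≡ true → S i j′ ≡ true
    column⊆ j j′ cq≤cq i Sij≡true = proj₁ (capture i j′) (*-cancelˡ-≤ (0<q j) (begin
      q j * P i j′         ≡⟨ cong (q j *_) (P≡pq i j′) ⟩
      q j * (p i * q j′)   ≡⟨ x∙yz≈z∙yx (q j) (p i) (q j′) ⟩
      q j′ * (p i * q j)   ≡⟨ cong (q j′ *_) (sym (P≡pq i j)) ⟩
      q j′ * P i j         ≤⟨ *-monoˡ-≤ (q j′) (proj₁ (0<q j′)) (proj₂ (capture i j) Sij≡true) ⟩
      q j′ * (r i * c j)   ≡⟨ x∙yz≈y∙zx (q j′) (r i) (c j) ⟩
      r i * (c j * q j′)   ≤⟨ *-monoˡ-≤ (r i) (0≤r i) cq≤cq ⟩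
      r i * (c j′ * q j)   ≡⟨ x∙yz≈z∙xy (r i) (c j′) (q j) ⟩
      q j * (r i * c j′)   ∎))

  threshold⇒captured : (∀ i → 0# < p i) → (∀ j → 0# < q j) →
                       ∀ {S} → IsThreshold S → Captured F P S
  threshold⇒captured 0<p 0<q {S} (a , b , threshold) =
    r , c , (λ i → proj₁ (0<r i)) , (λ j → *-nonneg (proj₁ (0<q j)) (fromℕ-nonneg (ℕ.suc (b j)))) ,
    λ i j → (λ P≤rc → Equivalence.from (threshold i j) (ℕ.≤-pred (fromℕ-cancel-≤ (P≤rc⇒α≤β P≤rc))))
          , (λ Sij≡true → α≤β⇒P≤rc (fromℕ-mono-≤ (ℕ.s≤s (Equivalence.to (threshold i j) Sij≡true))))
    where
    α : Fin m → Carrier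
    α i = fromℕ (ℕ.suc (a i))

    β : Fin n → Carrier
    β j = fromℕ (ℕ.suc (b j))

    r : Fin m → Carrier
    r i = p i * α i ⁻¹

    c : Fin n → Carrier
    c j = q j * β j

    0<r : ∀ i → 0# < r i
    0<r i = *-pos (0<p i) (⁻¹-pos (fromℕ-suc-pos (a i)))

    P≡r[qα] : ∀ i j → P i j ≡ r i * (q j * α i)
    P≡r[qα] i j = sym (begin-equality
      p i * α i ⁻¹ * (q j * α i)     ≡⟨ *-assoc (p i) (α i ⁻¹) (q j * α i) ⟩
      p i * (α i ⁻¹ * (q j * α i))   ≡⟨ cong (p i *_) (x∙yz≈y∙xz (α i ⁻¹) (q j) (α i)) ⟩
      p i * (q j * (α i ⁻¹ * α i))   ≡⟨ cong (λ x → p i * (q j * x)) (x⁻¹*x≡1 (fromℕ-suc-pos (a i))) ⟩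
      p i * (q j * 1#)               ≡⟨ cong (p i *_) (*-identityʳ (q j)) ⟩
      p i * q j                      ≡⟨ sym (P≡pq i j) ⟩
      P i j                          ∎)

    P≤rc⇒α≤β : ∀ {i j} → P i j ≤ r i * c j → α i ≤ β j
    P≤rc⇒α≤β {i} {j} P≤rc = *-cancelˡ-≤ (0<q j) (*-cancelˡ-≤ (0<r i) (subst (_≤ r i * c j) (P≡r[qα] i j) P≤rc))

    α≤β⇒P≤rc : ∀ {i j} → α i ≤ β j → P i j ≤ r i * c j
    α≤β⇒P≤rc {i} {j} α≤β = subst (_≤ r i * c j) (sym (P≡r[qα] i j))
      (*-monoˡ-≤ (r i) (proj₁ (0<r i)) (*-monoˡ-≤ (q j) (proj₁ (0<q j)) α≤β))

lemma8 : (F : OrderedField) → (m n : ℕ)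
    → (P : Fin m → Fin n → OrderedField.Carrier F)
    → (p : Fin m → OrderedField.Carrier F) → (q : Fin n → OrderedField.Carrier F)
    → (∀ i → OrderedField._<_ F (OrderedField.0# F) (p i))
    → (∀ j → OrderedField._<_ F (OrderedField.0# F) (q j))
    → (∀ i j → P i j ≡ OrderedField._*_ F (p i) (q j))
    → (S : Grid m n)
    → (Captured F P S → IsStaircase S) × (IsStaircase S → Captured F P S)
lemma8 F m n P p q 0<p 0<q P≡pq S =
  captured⇒staircase F P≡pq 0<q ,
  λ staircase → threshold⇒captured F P≡pq 0<p 0<q (staircase⇒threshold S staircase)
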